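{- Let $\mathcal{A}$ be an alphabet with $b\geq 2$ symbols, let $k,m$ be positive integers, and let $x=(x_0,x_1,\dots)$ be an infinite sequence over $\mathcal{A}$ that is $(k,m)$-perfect. Then: (1) $x$ passes every test of size $j\le k$; (2) for every integer $h>k+\log_{b} m$ there exists a test $t$ of size $h$ that rejects $x$.
   Context: A necklace is the equivalence class of a word under cyclic rotations; a word $u$ of length $k$ occurs in a necklace $[s]$ ($|s|=N$) at position $i$ if $s((i+t)\bmod N)=u(t)$ for $0\le t<k$; a necklace is $(k,m)$-perfect if it has length $m|\mathcal{A}|^k$ and each word of length $k$ occurs in it exactly $m$ times at positions pairwise different modulo $m$. An infinite sequence $x$ is $(k,m)$-perfect if it is periodic with period $m|\mathcal{A}|^k$ and the necklace $[x_0\dots x_{m|\mathcal{A}|^k-1}]$ is $(k,m)$-perfect. A test of size $k$ is a function $t:\mathcal{A}^k\to\mathbb{R}$; let $\tau=|\mathcal{A}|^{ -k}\sum_{y\in\mathcal{A}^k}t(y)$ and, for each $n$, $T_n(x_0,\dots,x_{n-1})=\bigl|\frac1n\sum_{i=0}^{n-1}t(x_i,\dots,x_{i+k-1})-\tau\bigr|$, where indices are taken with periodic boundary conditions $x_{n+j}=x_j$ (i.e. within the finite sample $x_0,\dots,x_{n-1}$ wrapped cyclically). The sequence $x$ passes the test $t$ if $\lim_{n\to\infty}T_n(x_0,\dots,x_{n-1})=0$; otherwise $t$ rejects $x$.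
   Formalization: The tests of size j ≤ k in part (1) take values in ℚ rather than ℝ, and the rejecting test of size h in part (2) is likewise rational-valued. -}

module Defs where

open import Data.Nat as ℕ using (ℕ; zero; suc; _^_; _*_; _≤_; _<_; NonZero)
open import Data.Nat.DivMod using (_%_; m%n<n)
open import Data.Fin as Fin using (Fin; toℕ; fromℕ<)
open import Data.Fin.Properties using (all?)
open import Data.Vec using (Vec; []; _∷_; lookup; tabulate)
open import Data.List using (List; [_]; map; concatMap; allFin; filter; length; foldr)
open import Data.Integer using (+_)
open import Data.Rational using (ℚ; 0ℚ; _/_; ∣_∣) renaming (_+_ to _+ℚ_; _*_ to _*ℚ_; _-_ to _-ℚ_; _<_ to _<ℚ_)
open import Data.Product using (Σ; _×_; ∃)
open import Relation.Binary.PropositionalEquality using (_≡_)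
open import Relation.Nullary using (Dec)
open import Data.Vec.Properties using ()

-- Alphabet 𝒜 with b symbols is modelled as Fin b; words of length k as Vec (Fin b) k.

allWords : (b j : ℕ) → List (Vec (Fin b) j)
allWords b zero = [ [] ]
allWords b (suc j) = concatMap (λ a → map (a ∷_) (allWords b j)) (allFin b)

sumℚ : List ℚ → ℚ
sumℚ = foldr _+ℚ_ 0ℚ

-- 1/n for n ≥ 1 (value at 0 is irrelevant: only used with n ≥ 1)
inv : ℕ → ℚ
inv zero = 0ℚ
inv (suc n) = + 1 / suc n

Test : (b j : ℕ) → Set
Test b j = Vec (Fin b) j → ℚ

tau : (b j : ℕ) → Test b j → ℚ
tau b j t = sumℚ (map t (allWords b j)) *ℚ inv (b ^ j)

-- T_n(x_0,…,x_{n-1}) with cyclic boundary conditions inside the sample,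
-- for n ≥ 1 (written as suc n); the value at n = 0 is irrelevant for the limit.
stat : ∀ {b j} → (ℕ → Fin b) → Test b j → ℕ → ℚ
stat {b} {j} x t zero = 0ℚ
stat {b} {j} x t (suc n) =
  ∣ sumℚ (map (λ i → t (tabulate (λ u → x ((toℕ i ℕ.+ toℕ u) % suc n)))) (allFin (suc n)))
      *ℚ inv (suc n) -ℚ tau b j t ∣

Passes : ∀ {b j} → (ℕ → Fin b) → Test b j → Set
Passes x t = ∀ (ε : ℚ) → 0ℚ <ℚ ε → ∃ λ N → ∀ n → N ≤ n → stat x t n <ℚ ε

idx : ∀ {N} → Fin N → ℕ → Fin N
idx {suc N} i t = fromℕ< (m%n<n (toℕ i ℕ.+ t) (suc N))

OccursAt : ∀ {A : Set} {N k} → Vec A N → Vec A k → Fin N → Set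
OccursAt {k = k} s u i = ∀ (t : Fin k) → lookup s (idx i (toℕ t)) ≡ lookup u t

occursAt? : ∀ {b N k} (s : Vec (Fin b) N) (u : Vec (Fin b) k) (i : Fin N) → Dec (OccursAt s u i)
occursAt? s u i = all? (λ t → lookup s (idx i (toℕ t)) Fin.≟ lookup u t)

occurrences : ∀ {b N k} → Vec (Fin b) N → Vec (Fin b) k → ℕ
occurrences {N = N} s u = length (filter (occursAt? s u) (allFin N))

-- (k,m)-perfect necklace (property of a representative; invariant under rotation)
PerfectNecklace : (b k m : ℕ) .{{_ : NonZero m}} → ∀ {N} → Vec (Fin b) N → Set
PerfectNecklace b k m {N} s =
  (N ≡ m * b ^ k) ×
  (∀ (u : Vec (Fin b) k) →
     (occurrences s u ≡ m) ×
     (∀ (i i′ : Fin N) → OccursAt s u i → OccursAt s u i′ →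
        toℕ i % m ≡ toℕ i′ % m → i ≡ i′))

PerfectSeq : (b k m : ℕ) .{{_ : NonZero m}} → (ℕ → Fin b) → Set
PerfectSeq b k m x =
  (∀ i → x (i ℕ.+ m * b ^ k) ≡ x i) ×
  PerfectNecklace b k m (tabulate {n = m * b ^ k} (λ i → x (toℕ i)))

{-# OPTIONS --safe #-}
module Submission where

-- Over one period the N = m b^k windows of x contain every word of length k exactly m times,
-- hence every word of length j ≤ k exactly m b^(k-j) times, so a test of size j averages
-- exactly τ over a period. A cyclically wrapped sample of length n consists of whole periods
-- plus fewer than N further windows, and differs from x only in its last j windows; so its
-- test sum is within a constant of n τ, and T_n = O(1/n).
-- Conversely, if N < b^h, the indicator of "occurs as a window of x" has τ ≤ N / b^h < 1,
-- while all but the last h windows of every sample occur in x; so T_n ≥ 1 - h/n - N / b^h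
-- stays away from 0.

open import Defs
open import Data.Nat as ℕ using (ℕ; zero; suc; _≤_; _<_; _*_; _^_; NonZero; z≤n; s≤s)
import Data.Nat.Properties as ℕP
open import Data.Nat.DivMod using (_%_; _/_; m%n<n; m≡m%n+[m/n]*n; m<n⇒m%n≡m)
import Data.Integer as ℤ
import Data.Integer.Properties as ℤP
open import Data.Fin as Fin using (Fin; toℕ; _↑ˡ_)
import Data.Fin.Properties as FinP
open import Data.Vec as Vec using (Vec; []; _∷_; lookup; take)
import Data.Vec.Properties as VecP
open import Data.List using (List; []; _∷_; map; _++_; concatMap; allFin; filter; length)
import Data.List.Properties as ListP
open import Data.Rational as ℚ using (ℚ; mkℚ; 0ℚ; 1ℚ; ½; ∣_∣; toℚᵘ; _+_; _-_; -_)
  renaming (_*_ to _*ℚ_; _≤_ to _≤ℚ_; _<_ to _<ℚ_)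
import Data.Rational.Properties as ℚP
open import Data.Rational.Unnormalised as ℚᵘ using (mkℚᵘ)
import Data.Rational.Unnormalised.Properties as ℚᵘP
open import Data.Rational.Solver using (module +-*-Solver)
open import Algebra.Bundles using (Ring)
open import Algebra.Properties.Semiring.Mult (Ring.semiring ℚP.+-*-ring)
  using (×1-homo-*) renaming (_×_ to _×ℚ_)
open import Data.Product using (_×_; ∃; _,_; proj₁; proj₂)
open import Data.Empty using (⊥-elim)
open import Function using (_∘_; id)
open import Relation.Nullary using (¬_; Dec; yes; no)
open import Relation.Binary.PropositionalEquality

open +-*-Solver using (solve; _:+_; _:-_; _:*_; _:=_; con)

-- Natural numbers in ℚ

fromℕ : ℕ → ℚ
fromℕ n = n ×ℚ 1ℚ

fromℕ-* : ∀ m n → fromℕ (m * n) ≡ fromℕ m *ℚ fromℕ n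
fromℕ-* = ×1-homo-*

toℚᵘ-fromℕ : ∀ n → toℚᵘ (fromℕ n) ℚᵘ.≃ mkℚᵘ (ℤ.+ n) 0
toℚᵘ-fromℕ zero    = ℚᵘP.≃-refl
toℚᵘ-fromℕ (suc n) = ℚᵘP.≃-trans (ℚP.toℚᵘ-homo-+ 1ℚ (fromℕ n))
  (ℚᵘP.≃-trans (ℚᵘP.+-congʳ (toℚᵘ 1ℚ) (toℚᵘ-fromℕ n)) (ℚᵘ.*≡* eq))
  where
  eq : (ℤ.+ 1 ℤ.* ℤ.+ 1 ℤ.+ ℤ.+ n ℤ.* ℤ.+ 1) ℤ.* ℤ.+ 1 ≡ ℤ.+ suc n ℤ.* ℤ.+ 1
  eq rewrite ℤP.*-identityʳ (ℤ.+ n) = refl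

inv-*-fromℕ : ∀ n .{{_ : NonZero n}} → inv n *ℚ fromℕ n ≡ 1ℚ
inv-*-fromℕ (suc n) = ℚP.toℚᵘ-injective
  (ℚᵘP.≃-trans (ℚP.toℚᵘ-homo-* (inv (suc n)) (fromℕ (suc n)))
  (ℚᵘP.≃-trans (ℚᵘP.*-cong (ℚP.toℚᵘ-fromℚᵘ (mkℚᵘ (ℤ.+ 1) n)) (toℚᵘ-fromℕ (suc n)))
               (ℚᵘP.*-inverseˡ (mkℚᵘ (ℤ.+ suc n) 0))))

inv-pos : ∀ n .{{_ : NonZero n}} → ℚ.Positive (inv n)
inv-pos (suc n) = ℚP.normalize-pos 1 (suc n)

0≤inv : ∀ n → 0ℚ ≤ℚ inv n
0≤inv zero    = ℚP.≤-refl
0≤inv (suc n) = ℚP.<⇒≤ (ℚP.positive⁻¹ (inv (suc n)) {{inv-pos (suc n)}})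

0≤fromℕ : ∀ n → 0ℚ ≤ℚ fromℕ n
0≤fromℕ zero    = ℚP.≤-refl
0≤fromℕ (suc n) = ℚP.+-mono-≤ (ℚP.nonNegative⁻¹ 1ℚ) (0≤fromℕ n)

fromℕ-mono-≤ : ∀ {m n} → m ≤ n → fromℕ m ≤ℚ fromℕ n
fromℕ-mono-≤ {n = n} z≤n = 0≤fromℕ n
fromℕ-mono-≤ (s≤s m≤n)   = ℚP.+-monoʳ-≤ 1ℚ (fromℕ-mono-≤ m≤n)

fromℕ-mono-< : ∀ {m n} → m < n → fromℕ m <ℚ fromℕ n
fromℕ-mono-< {m} (s≤s m≤n) = ℚP.≤-<-trans (ℚP.≤-reflexive (sym (ℚP.+-identityˡ (fromℕ m))))
  (ℚP.+-mono-<-≤ (ℚP.positive⁻¹ 1ℚ) (fromℕ-mono-≤ m≤n))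

archimedean : ∀ q → ∃ λ n → q <ℚ fromℕ n
archimedean q@(mkℚ ℤ.-[1+ _ ] _ _) = 0 , ℚP.negative⁻¹ q
archimedean (mkℚ (ℤ.+ n) d _)      = suc n ,
  ℚP.toℚᵘ-cancel-< (ℚᵘP.<-respʳ-≃ (ℚᵘP.≃-sym (toℚᵘ-fromℕ (suc n))) (ℚᵘ.*<* n<[1+n][1+d]))
  where
  n<[1+n][1+d] : ℤ.+ n ℤ.* ℤ.+ 1 ℤ.< ℤ.+ suc n ℤ.* ℤ.+ suc d
  n<[1+n][1+d] rewrite ℤP.*-identityʳ (ℤ.+ n) | sym (ℤP.pos-* (suc n) (suc d)) =
    ℤ.+<+ (ℕP.<-≤-trans (ℕP.n<1+n n) (ℕP.m≤m*n (suc n) (suc d)))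

p≤q⇒p-q≤0 : ∀ {p q} → p ≤ℚ q → p - q ≤ℚ 0ℚ
p≤q⇒p-q≤0 {q = q} p≤q = ℚP.≤-trans (ℚP.+-monoˡ-≤ (- q) p≤q) (ℚP.≤-reflexive (ℚP.+-inverseʳ q))

*-monoʳ-≤-nonNeg′ : ∀ {r p q} → 0ℚ ≤ℚ r → p ≤ℚ q → p *ℚ r ≤ℚ q *ℚ r
*-monoʳ-≤-nonNeg′ {r} 0≤r = ℚP.*-monoʳ-≤-nonNeg r {{ℚ.nonNegative 0≤r}}

*-inv-suc-eventually-< : ∀ C ε → 0ℚ <ℚ ε → ∃ λ K → ∀ n → K ≤ suc n → C *ℚ inv (suc n) <ℚ ε
*-inv-suc-eventually-< C ε 0<ε = K , below
  where
  instance
    ε≢0 : ℚ.NonZero ε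
    ε≢0 = ℚ.>-nonZero 0<ε
  K = proj₁ (archimedean (C *ℚ ℚ.1/ ε))
  C/ε<K : C *ℚ ℚ.1/ ε <ℚ fromℕ K
  C/ε<K = proj₂ (archimedean (C *ℚ ℚ.1/ ε))
  below : ∀ n → K ≤ suc n → C *ℚ inv (suc n) <ℚ ε
  below n K≤1+n = begin-strict
    C *ℚ inv (suc n)                     ≡⟨ cong (_*ℚ inv (suc n)) C/ε*ε≡C ⟨
    C *ℚ ℚ.1/ ε *ℚ ε *ℚ inv (suc n)      <⟨ ℚP.*-monoˡ-<-pos (inv (suc n)) {{inv-pos (suc n)}} C/ε*ε<[1+n]ε ⟩
    fromℕ (suc n) *ℚ ε *ℚ inv (suc n)    ≡⟨ regroup (fromℕ (suc n)) ε (inv (suc n)) ⟩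
    ε *ℚ (inv (suc n) *ℚ fromℕ (suc n))  ≡⟨ cong (ε *ℚ_) (inv-*-fromℕ (suc n)) ⟩
    ε *ℚ 1ℚ                              ≡⟨ ℚP.*-identityʳ ε ⟩
    ε                                    ∎
    where
    open ℚP.≤-Reasoning
    C/ε*ε≡C : C *ℚ ℚ.1/ ε *ℚ ε ≡ C
    C/ε*ε≡C = trans (ℚP.*-assoc C _ ε) (trans (cong (C *ℚ_) (ℚP.*-inverseˡ ε)) (ℚP.*-identityʳ C))
    C/ε*ε<[1+n]ε : C *ℚ ℚ.1/ ε *ℚ ε <ℚ fromℕ (suc n) *ℚ ε
    C/ε*ε<[1+n]ε = ℚP.<-≤-trans (ℚP.*-monoˡ-<-pos ε {{ℚ.positive 0<ε}} C/ε<K)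
      (*-monoʳ-≤-nonNeg′ (ℚP.<⇒≤ 0<ε) (fromℕ-mono-≤ K≤1+n))
    regroup : ∀ a b c → a *ℚ b *ℚ c ≡ b *ℚ (c *ℚ a)
    regroup = solve 3 (λ a b c → a :* b :* c := b :* (c :* a)) refl

-- Indicators and finite sums

𝟙 : ∀ {P : Set} → Dec P → ℚ
𝟙 (yes _) = 1ℚ
𝟙 (no _)  = 0ℚ

𝟙-yes : ∀ {P : Set} → P → (d : Dec P) → 𝟙 d ≡ 1ℚ
𝟙-yes p (yes _) = refl
𝟙-yes p (no ¬p) = ⊥-elim (¬p p)

𝟙-no : ∀ {P : Set} → ¬ P → (d : Dec P) → 𝟙 d ≡ 0ℚ
𝟙-no ¬p (yes p) = ⊥-elim (¬p p)
𝟙-no ¬p (no _)  = refl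

𝟙-cong : ∀ {P Q : Set} → (P → Q) → (Q → P) → (d : Dec P) (e : Dec Q) → 𝟙 d ≡ 𝟙 e
𝟙-cong P→Q Q→P (yes p) e = sym (𝟙-yes (P→Q p) e)
𝟙-cong P→Q Q→P (no ¬p) e = sym (𝟙-no (¬p ∘ Q→P) e)

0≤𝟙 : ∀ {P : Set} (d : Dec P) → 0ℚ ≤ℚ 𝟙 d
0≤𝟙 (yes _) = ℚP.nonNegative⁻¹ 1ℚ
0≤𝟙 (no _)  = ℚP.≤-refl

𝟙≤1 : ∀ {P : Set} (d : Dec P) → 𝟙 d ≤ℚ 1ℚ
𝟙≤1 (yes _) = ℚP.≤-refl
𝟙≤1 (no _)  = ℚP.nonNegative⁻¹ 1ℚ

∑< : ℕ → (ℕ → ℚ) → ℚ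
∑< zero    f = 0ℚ
∑< (suc n) f = f 0 + ∑< n (f ∘ suc)

syntax ∑< n (λ i → e) = ∑[ i < n ] e

∑<-cong : ∀ n {f g : ℕ → ℚ} → (∀ i → i < n → f i ≡ g i) → ∑< n f ≡ ∑< n g
∑<-cong zero    f≗g = refl
∑<-cong (suc n) f≗g = cong₂ _+_ (f≗g 0 (s≤s z≤n)) (∑<-cong n (λ i → f≗g (suc i) ∘ s≤s))

∑<-distrib-+ : ∀ n (f g : ℕ → ℚ) → ∑[ i < n ] (f i + g i) ≡ ∑< n f + ∑< n g
∑<-distrib-+ zero    f g = sym (ℚP.+-identityˡ 0ℚ)
∑<-distrib-+ (suc n) f g = trans (cong ((f 0 + g 0) +_) (∑<-distrib-+ n (f ∘ suc) (g ∘ suc)))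
  (interchange (f 0) (g 0) (∑< n (f ∘ suc)) (∑< n (g ∘ suc)))
  where
  interchange : ∀ a b c d → (a + b) + (c + d) ≡ (a + c) + (b + d)
  interchange = solve 4 (λ a b c d → (a :+ b) :+ (c :+ d) := (a :+ c) :+ (b :+ d)) refl

∑<-distrib-- : ∀ n (f g : ℕ → ℚ) → ∑[ i < n ] (f i - g i) ≡ ∑< n f - ∑< n g
∑<-distrib-- zero    f g = refl
∑<-distrib-- (suc n) f g = trans (cong ((f 0 - g 0) +_) (∑<-distrib-- n (f ∘ suc) (g ∘ suc)))
  (interchange (f 0) (g 0) (∑< n (f ∘ suc)) (∑< n (g ∘ suc)))
  where
  interchange : ∀ a b c d → (a - b) + (c - d) ≡ (a + c) - (b + d)
  interchange = solve 4 (λ a b c d → (a :- b) :+ (c :- d) := (a :+ c) :- (b :+ d)) refl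

*-distribʳ-∑< : ∀ n (f : ℕ → ℚ) c → ∑< n f *ℚ c ≡ ∑[ i < n ] (f i *ℚ c)
*-distribʳ-∑< zero    f c = ℚP.*-zeroˡ c
*-distribʳ-∑< (suc n) f c = trans (ℚP.*-distribʳ-+ c (f 0) (∑< n (f ∘ suc)))
  (cong (f 0 *ℚ c +_) (*-distribʳ-∑< n (f ∘ suc) c))

∑<-const : ∀ n c → ∑[ i < n ] c ≡ fromℕ n *ℚ c
∑<-const zero    c = sym (ℚP.*-zeroˡ c)
∑<-const (suc n) c = trans (cong₂ _+_ (sym (ℚP.*-identityˡ c)) (∑<-const n c))
  (sym (ℚP.*-distribʳ-+ c 1ℚ (fromℕ n)))

∑<-zero : ∀ n → ∑[ i < n ] 0ℚ ≡ 0ℚ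
∑<-zero n = trans (∑<-const n 0ℚ) (ℚP.*-zeroʳ (fromℕ n))

∑<-+ : ∀ m n (f : ℕ → ℚ) → ∑< (m ℕ.+ n) f ≡ ∑< m f + ∑[ i < n ] f (m ℕ.+ i)
∑<-+ zero    n f = sym (ℚP.+-identityˡ _)
∑<-+ (suc m) n f = trans (cong (f 0 +_) (∑<-+ m n (f ∘ suc))) (sym (ℚP.+-assoc (f 0) _ _))

∑<-nonNeg : ∀ n {f : ℕ → ℚ} → (∀ i → 0ℚ ≤ℚ f i) → 0ℚ ≤ℚ ∑< n f
∑<-nonNeg zero    0≤f = ℚP.≤-refl
∑<-nonNeg (suc n) 0≤f = ℚP.+-mono-≤ (0≤f 0) (∑<-nonNeg n (0≤f ∘ suc))

term≤∑< : ∀ n {f : ℕ → ℚ} → (∀ i → 0ℚ ≤ℚ f i) → ∀ {i} → i < n → f i ≤ℚ ∑< n f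
term≤∑< (suc n) {f} 0≤f {zero} _ = begin
  f 0            ≡⟨ ℚP.+-identityʳ (f 0) ⟨
  f 0 + 0ℚ       ≤⟨ ℚP.+-monoʳ-≤ (f 0) (∑<-nonNeg n (0≤f ∘ suc)) ⟩
  ∑< (suc n) f   ∎
  where open ℚP.≤-Reasoning
term≤∑< (suc n) {f} 0≤f {suc i} (s≤s i<n) = begin
  f (suc i)            ≤⟨ term≤∑< n (0≤f ∘ suc) i<n ⟩
  ∑< n (f ∘ suc)       ≡⟨ ℚP.+-identityˡ _ ⟨
  0ℚ + ∑< n (f ∘ suc)  ≤⟨ ℚP.+-monoˡ-≤ _ (0≤f 0) ⟩
  ∑< (suc n) f         ∎
  where open ℚP.≤-Reasoning

∣∑<∣≤ : ∀ n (f : ℕ → ℚ) {M} → (∀ i → i < n → ∣ f i ∣ ≤ℚ M) → ∣ ∑< n f ∣ ≤ℚ fromℕ n *ℚ M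
∣∑<∣≤ zero    f {M} _   = ℚP.≤-reflexive (sym (ℚP.*-zeroˡ M))
∣∑<∣≤ (suc n) f {M} f≤M = begin
  ∣ f 0 + ∑< n (f ∘ suc) ∣          ≤⟨ ℚP.∣p+q∣≤∣p∣+∣q∣ (f 0) _ ⟩
  ∣ f 0 ∣ + ∣ ∑< n (f ∘ suc) ∣      ≤⟨ ℚP.+-mono-≤ (f≤M 0 (s≤s z≤n))
                                                   (∣∑<∣≤ n (f ∘ suc) (λ i → f≤M (suc i) ∘ s≤s)) ⟩
  M + fromℕ n *ℚ M                  ≡⟨ cong (_+ fromℕ n *ℚ M) (ℚP.*-identityˡ M) ⟨
  1ℚ *ℚ M + fromℕ n *ℚ M            ≡⟨ ℚP.*-distribʳ-+ M 1ℚ (fromℕ n) ⟨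
  fromℕ (suc n) *ℚ M                ∎
  where open ℚP.≤-Reasoning

∣∑<∣≤-tail : ∀ n j (f : ℕ → ℚ) {E} → (∀ i → ∣ f i ∣ ≤ℚ E) → (∀ i → i ℕ.+ j ≤ n → f i ≡ 0ℚ) →
  ∣ ∑< n f ∣ ≤ℚ fromℕ j *ℚ E
∣∑<∣≤-tail n j f {E} f≤E vanish with n ℕ.≤? j
... | yes n≤j = ℚP.≤-trans (∣∑<∣≤ n f (λ i _ → f≤E i))
  (*-monoʳ-≤-nonNeg′ (ℚP.≤-trans (ℚP.0≤∣p∣ (f 0)) (f≤E 0)) (fromℕ-mono-≤ n≤j))
∣∑<∣≤-tail zero    j f f≤E vanish | no 0≰j = ⊥-elim (0≰j z≤n)
∣∑<∣≤-tail (suc n) j f f≤E vanish | no n≰j = begin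
  ∣ f 0 + ∑< n (f ∘ suc) ∣   ≡⟨ cong (λ z → ∣ z + ∑< n (f ∘ suc) ∣) (vanish 0 (ℕP.≰⇒≥ n≰j)) ⟩
  ∣ 0ℚ + ∑< n (f ∘ suc) ∣    ≡⟨ cong ∣_∣ (ℚP.+-identityˡ _) ⟩
  ∣ ∑< n (f ∘ suc) ∣         ≤⟨ ∣∑<∣≤-tail n j (f ∘ suc) (f≤E ∘ suc) (λ i → vanish (suc i) ∘ s≤s) ⟩
  _                          ∎
  where open ℚP.≤-Reasoning

∑<-≥-tail : ∀ n h (f : ℕ → ℚ) → (∀ i → 0ℚ ≤ℚ f i) → (∀ i → i ℕ.+ h ≤ n → f i ≡ 1ℚ) →
  fromℕ n - fromℕ h ≤ℚ ∑< n f
∑<-≥-tail n h f 0≤f one with n ℕ.≤? h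
... | yes n≤h = ℚP.≤-trans (p≤q⇒p-q≤0 (fromℕ-mono-≤ n≤h)) (∑<-nonNeg n 0≤f)
∑<-≥-tail zero    h f 0≤f one | no 0≰h = ⊥-elim (0≰h z≤n)
∑<-≥-tail (suc n) h f 0≤f one | no n≰h = begin
  fromℕ (suc n) - fromℕ h        ≡⟨ ℚP.+-assoc 1ℚ (fromℕ n) (- fromℕ h) ⟩
  1ℚ + (fromℕ n - fromℕ h)       ≤⟨ ℚP.+-mono-≤ (ℚP.≤-reflexive (sym (one 0 (ℕP.≰⇒≥ n≰h))))
                                                (∑<-≥-tail n h (f ∘ suc) (0≤f ∘ suc) (λ i → one (suc i) ∘ s≤s)) ⟩
  f 0 + ∑< n (f ∘ suc)           ∎
  where open ℚP.≤-Reasoning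

-- Periodic sequences

Periodic : ∀ {A : Set} → ℕ → (ℕ → A) → Set
Periodic N f = ∀ i → f (i ℕ.+ N) ≡ f i

module _ {A : Set} {N} {f : ℕ → A} (periodic : Periodic N f) where

  periodic-*+ : ∀ q i → f (q * N ℕ.+ i) ≡ f i
  periodic-*+ zero    i = refl
  periodic-*+ (suc q) i = trans (cong f (trans (ℕP.+-assoc N (q * N) i) (ℕP.+-comm N _)))
    (trans (periodic _) (periodic-*+ q i))

  periodic-% : .{{_ : NonZero N}} → ∀ i → f (i % N) ≡ f i
  periodic-% i = trans (sym (periodic-*+ (i / N) (i % N)))
    (cong f (sym (trans (m≡m%n+[m/n]*n i N) (ℕP.+-comm (i % N) _))))

module _ {N} {f : ℕ → ℚ} (periodic : Periodic N f) (∑<-period : ∑< N f ≡ 0ℚ) where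

  ∑<-periods : ∀ q → ∑< (q * N) f ≡ 0ℚ
  ∑<-periods zero    = refl
  ∑<-periods (suc q) = begin
    ∑< (N ℕ.+ q * N) f                      ≡⟨ ∑<-+ N (q * N) f ⟩
    ∑< N f + ∑[ i < q * N ] f (N ℕ.+ i)     ≡⟨ cong₂ _+_ ∑<-period (∑<-cong (q * N) (λ i _ → shift i)) ⟩
    0ℚ + ∑< (q * N) f                       ≡⟨ cong (0ℚ +_) (∑<-periods q) ⟩
    0ℚ                                      ∎
    where
    open ≡-Reasoning
    shift : ∀ i → f (N ℕ.+ i) ≡ f i
    shift i = trans (cong f (ℕP.+-comm N i)) (periodic i)

  ∣∑<∣≤-periodic : .{{_ : NonZero N}} → ∀ {D} → (∀ i → ∣ f i ∣ ≤ℚ D) → ∀ n → ∣ ∑< n f ∣ ≤ℚ fromℕ N *ℚ D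
  ∣∑<∣≤-periodic {D} f≤D n = begin
    ∣ ∑< n f ∣                                        ≡⟨ cong (λ n → ∣ ∑< n f ∣) n≡q*N+r ⟩
    ∣ ∑< (q * N ℕ.+ r) f ∣                            ≡⟨ cong ∣_∣ (∑<-+ (q * N) r f) ⟩
    ∣ ∑< (q * N) f + ∑[ i < r ] f (q * N ℕ.+ i) ∣     ≡⟨ cong ∣_∣ (cong₂ _+_ (∑<-periods q)
                                                           (∑<-cong r (λ i _ → periodic-*+ periodic q i))) ⟩
    ∣ 0ℚ + ∑< r f ∣                                   ≡⟨ cong ∣_∣ (ℚP.+-identityˡ _) ⟩
    ∣ ∑< r f ∣                                        ≤⟨ ∣∑<∣≤ r f (λ i _ → f≤D i) ⟩
    fromℕ r *ℚ D                                      ≤⟨ *-monoʳ-≤-nonNeg′ (ℚP.≤-trans (ℚP.0≤∣p∣ (f 0)) (f≤D 0))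
                                                                          (fromℕ-mono-≤ (ℕP.<⇒≤ (m%n<n n N))) ⟩
    fromℕ N *ℚ D                                      ∎
    where
    open ℚP.≤-Reasoning
    q = n / N
    r = n % N
    n≡q*N+r : n ≡ q * N ℕ.+ r
    n≡q*N+r = trans (m≡m%n+[m/n]*n n N) (ℕP.+-comm r (q * N))

∑∈ : ∀ {A : Set} → List A → (A → ℚ) → ℚ
∑∈ L f = sumℚ (map f L)

syntax ∑∈ L (λ a → e) = ∑[ a ∈ L ] e

∑∈-cong : ∀ {A : Set} (L : List A) {f g : A → ℚ} → (∀ a → f a ≡ g a) → ∑∈ L f ≡ ∑∈ L g
∑∈-cong []      f≗g = refl
∑∈-cong (a ∷ L) f≗g = cong₂ _+_ (f≗g a) (∑∈-cong L f≗g)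

∑∈-mono : ∀ {A : Set} (L : List A) {f g : A → ℚ} → (∀ a → f a ≤ℚ g a) → ∑∈ L f ≤ℚ ∑∈ L g
∑∈-mono []      f≤g = ℚP.≤-refl
∑∈-mono (a ∷ L) f≤g = ℚP.+-mono-≤ (f≤g a) (∑∈-mono L f≤g)

∑∈-zero : ∀ {A : Set} (L : List A) → ∑[ a ∈ L ] 0ℚ ≡ 0ℚ
∑∈-zero []      = refl
∑∈-zero (a ∷ L) = trans (ℚP.+-identityˡ _) (∑∈-zero L)

*-distribˡ-∑∈ : ∀ {A : Set} (L : List A) c (f : A → ℚ) → c *ℚ ∑∈ L f ≡ ∑[ a ∈ L ] (c *ℚ f a)
*-distribˡ-∑∈ []      c f = ℚP.*-zeroʳ c
*-distribˡ-∑∈ (a ∷ L) c f = trans (ℚP.*-distribˡ-+ c (f a) (∑∈ L f))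
  (cong (c *ℚ f a +_) (*-distribˡ-∑∈ L c f))

∑∈-++ : ∀ {A : Set} (L M : List A) (f : A → ℚ) → ∑∈ (L ++ M) f ≡ ∑∈ L f + ∑∈ M f
∑∈-++ []      M f = sym (ℚP.+-identityˡ _)
∑∈-++ (a ∷ L) M f = trans (cong (f a +_) (∑∈-++ L M f)) (sym (ℚP.+-assoc (f a) _ _))

∑∈-map : ∀ {A B : Set} (g : A → B) (L : List A) (f : B → ℚ) → ∑∈ (map g L) f ≡ ∑∈ L (f ∘ g)
∑∈-map g []      f = refl
∑∈-map g (a ∷ L) f = cong (f (g a) +_) (∑∈-map g L f)

∑∈-concatMap : ∀ {A B : Set} (F : A → List B) (L : List A) (f : B → ℚ) →
  ∑∈ (concatMap F L) f ≡ ∑[ a ∈ L ] ∑∈ (F a) f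
∑∈-concatMap F []      f = refl
∑∈-concatMap F (a ∷ L) f = trans (∑∈-++ (F a) (concatMap F L) f)
  (cong (∑∈ (F a) f +_) (∑∈-concatMap F L f))

∑∈-∑<-comm : ∀ {A : Set} (L : List A) n (F : A → ℕ → ℚ) →
  ∑[ a ∈ L ] ∑< n (F a) ≡ ∑[ i < n ] ∑[ a ∈ L ] F a i
∑∈-∑<-comm []      n F = sym (∑<-zero n)
∑∈-∑<-comm (a ∷ L) n F = trans (cong (∑< n (F a) +_) (∑∈-∑<-comm L n F))
  (sym (∑<-distrib-+ n (F a) _))

∑∈-allFin-suc : ∀ n (g : Fin (suc n) → ℚ) →
  ∑∈ (allFin (suc n)) g ≡ g Fin.zero + ∑[ a ∈ allFin n ] g (Fin.suc a)
∑∈-allFin-suc n g = cong (λ L → g Fin.zero + sumℚ L)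
  (trans (ListP.map-tabulate Fin.suc g) (sym (ListP.map-tabulate id (g ∘ Fin.suc))))

∑∈-allFin : ∀ n (f : ℕ → ℚ) → ∑[ i ∈ allFin n ] f (toℕ i) ≡ ∑< n f
∑∈-allFin zero    f = refl
∑∈-allFin (suc n) f = trans (∑∈-allFin-suc n (f ∘ toℕ)) (cong (f 0 +_) (∑∈-allFin n (f ∘ suc)))

length-filter : ∀ {A : Set} {P : A → Set} (P? : ∀ a → Dec (P a)) (L : List A) →
  fromℕ (length (filter P? L)) ≡ ∑[ a ∈ L ] 𝟙 (P? a)
length-filter P? []      = refl
length-filter P? (a ∷ L) with P? a
... | yes _ = cong (1ℚ +_) (length-filter P? L)
... | no _  = trans (length-filter P? L) (sym (ℚP.+-identityˡ _))

-- Sums over all words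

_≟ᵥ_ : ∀ {b j} (u v : Vec (Fin b) j) → Dec (u ≡ v)
_≟ᵥ_ = VecP.≡-dec Fin._≟_

𝟙-∷ : ∀ {b j} (c a : Fin b) (v w : Vec (Fin b) j) →
  𝟙 ((c ∷ v) ≟ᵥ (a ∷ w)) ≡ 𝟙 (c Fin.≟ a) *ℚ 𝟙 (v ≟ᵥ w)
𝟙-∷ c a v w with c Fin.≟ a | v ≟ᵥ w
... | yes _ | yes _ = refl
... | yes _ | no _  = refl
... | no _  | yes _ = refl
... | no _  | no _  = refl

∑-allWords-suc : ∀ b j (g : Vec (Fin b) (suc j) → ℚ) →
  ∑∈ (allWords b (suc j)) g ≡ ∑[ a ∈ allFin b ] ∑[ w ∈ allWords b j ] g (a ∷ w)
∑-allWords-suc b j g = trans (∑∈-concatMap (λ a → map (a ∷_) (allWords b j)) (allFin b) g)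
  (∑∈-cong (allFin b) (λ a → ∑∈-map (a ∷_) (allWords b j) g))

∑-allFin-δ : ∀ {b} (c : Fin b) (g : Fin b → ℚ) → ∑[ a ∈ allFin b ] (𝟙 (c Fin.≟ a) *ℚ g a) ≡ g c
∑-allFin-δ {suc b} Fin.zero g = begin
  ∑[ a ∈ allFin (suc b) ] (𝟙 (Fin.zero Fin.≟ a) *ℚ g a)
    ≡⟨ ∑∈-allFin-suc b (λ a → 𝟙 (Fin.zero Fin.≟ a) *ℚ g a) ⟩
  1ℚ *ℚ g Fin.zero + ∑[ a ∈ allFin b ] (0ℚ *ℚ g (Fin.suc a))
    ≡⟨ cong₂ _+_ (ℚP.*-identityˡ (g Fin.zero))
                 (trans (∑∈-cong (allFin b) (ℚP.*-zeroˡ ∘ g ∘ Fin.suc)) (∑∈-zero (allFin b))) ⟩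
  g Fin.zero + 0ℚ
    ≡⟨ ℚP.+-identityʳ _ ⟩
  g Fin.zero ∎
  where open ≡-Reasoning
∑-allFin-δ {suc b} (Fin.suc c) g = begin
  ∑[ a ∈ allFin (suc b) ] (𝟙 (Fin.suc c Fin.≟ a) *ℚ g a)
    ≡⟨ ∑∈-allFin-suc b (λ a → 𝟙 (Fin.suc c Fin.≟ a) *ℚ g a) ⟩
  0ℚ *ℚ g Fin.zero + ∑[ a ∈ allFin b ] (𝟙 (Fin.suc c Fin.≟ Fin.suc a) *ℚ g (Fin.suc a))
    ≡⟨ cong₂ _+_ (ℚP.*-zeroˡ (g Fin.zero)) (∑∈-cong (allFin b) (λ a → cong (_*ℚ g (Fin.suc a))
         (𝟙-cong FinP.suc-injective (cong Fin.suc) (Fin.suc c Fin.≟ Fin.suc a) (c Fin.≟ a)))) ⟩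
  0ℚ + ∑[ a ∈ allFin b ] (𝟙 (c Fin.≟ a) *ℚ g (Fin.suc a))
    ≡⟨ cong (0ℚ +_) (∑-allFin-δ c (g ∘ Fin.suc)) ⟩
  0ℚ + g (Fin.suc c)
    ≡⟨ ℚP.+-identityˡ _ ⟩
  g (Fin.suc c) ∎
  where open ≡-Reasoning

∑-allWords-δ : ∀ {b j} (v : Vec (Fin b) j) (g : Vec (Fin b) j → ℚ) →
  ∑[ u ∈ allWords b j ] (𝟙 (v ≟ᵥ u) *ℚ g u) ≡ g v
∑-allWords-δ [] g = trans (ℚP.+-identityʳ _) (ℚP.*-identityˡ (g []))
∑-allWords-δ {b} {suc j} (c ∷ v) g = begin
  ∑[ u ∈ allWords b (suc j) ] (𝟙 ((c ∷ v) ≟ᵥ u) *ℚ g u)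
    ≡⟨ ∑-allWords-suc b j _ ⟩
  ∑[ a ∈ allFin b ] ∑[ w ∈ allWords b j ] (𝟙 ((c ∷ v) ≟ᵥ (a ∷ w)) *ℚ g (a ∷ w))
    ≡⟨ ∑∈-cong (allFin b) (λ a → ∑∈-cong (allWords b j) (λ w →
         trans (cong (_*ℚ g (a ∷ w)) (𝟙-∷ c a v w)) (ℚP.*-assoc (𝟙 (c Fin.≟ a)) _ _))) ⟩
  ∑[ a ∈ allFin b ] ∑[ w ∈ allWords b j ] (𝟙 (c Fin.≟ a) *ℚ (𝟙 (v ≟ᵥ w) *ℚ g (a ∷ w)))
    ≡⟨ ∑∈-cong (allFin b) (λ a → sym (*-distribˡ-∑∈ (allWords b j) (𝟙 (c Fin.≟ a)) _)) ⟩
  ∑[ a ∈ allFin b ] (𝟙 (c Fin.≟ a) *ℚ ∑[ w ∈ allWords b j ] (𝟙 (v ≟ᵥ w) *ℚ g (a ∷ w)))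
    ≡⟨ ∑∈-cong (allFin b) (λ a → cong (𝟙 (c Fin.≟ a) *ℚ_) (∑-allWords-δ v (g ∘ (a ∷_)))) ⟩
  ∑[ a ∈ allFin b ] (𝟙 (c Fin.≟ a) *ℚ g (a ∷ v))
    ≡⟨ ∑-allFin-δ c (g ∘ (_∷ v)) ⟩
  g (c ∷ v) ∎
  where open ≡-Reasoning

∑-allWords-const : ∀ b d c → ∑[ u ∈ allWords b d ] c ≡ fromℕ (b ^ d) *ℚ c
∑-allWords-const b zero    c = trans (ℚP.+-identityʳ c) (sym (ℚP.*-identityˡ c))
∑-allWords-const b (suc d) c = begin
  ∑[ u ∈ allWords b (suc d) ] c                    ≡⟨ ∑-allWords-suc b d _ ⟩
  ∑[ a ∈ allFin b ] ∑[ w ∈ allWords b d ] c        ≡⟨ ∑∈-cong (allFin b) (λ _ → ∑-allWords-const b d c) ⟩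
  ∑[ a ∈ allFin b ] (fromℕ (b ^ d) *ℚ c)           ≡⟨ ∑∈-allFin b _ ⟩
  ∑[ i < b ] (fromℕ (b ^ d) *ℚ c)                  ≡⟨ ∑<-const b _ ⟩
  fromℕ b *ℚ (fromℕ (b ^ d) *ℚ c)                  ≡⟨ ℚP.*-assoc (fromℕ b) _ c ⟨
  fromℕ b *ℚ fromℕ (b ^ d) *ℚ c                    ≡⟨ cong (_*ℚ c) (fromℕ-* b (b ^ d)) ⟨
  fromℕ (b ^ suc d) *ℚ c                           ∎
  where open ≡-Reasoning

∑-allWords-take : ∀ b j d (g : Vec (Fin b) j → ℚ) →
  ∑[ u ∈ allWords b (j ℕ.+ d) ] g (take j u) ≡ fromℕ (b ^ d) *ℚ ∑∈ (allWords b j) g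
∑-allWords-take b zero    d g = trans (∑-allWords-const b d (g []))
  (cong (fromℕ (b ^ d) *ℚ_) (sym (ℚP.+-identityʳ (g []))))
∑-allWords-take b (suc j) d g = begin
  ∑[ u ∈ allWords b (suc j ℕ.+ d) ] g (take (suc j) u)          ≡⟨ ∑-allWords-suc b (j ℕ.+ d) _ ⟩
  ∑[ a ∈ allFin b ] ∑[ w ∈ allWords b (j ℕ.+ d) ] g (a ∷ take j w)
    ≡⟨ ∑∈-cong (allFin b) (λ a → ∑-allWords-take b j d (g ∘ (a ∷_))) ⟩
  ∑[ a ∈ allFin b ] (fromℕ (b ^ d) *ℚ ∑[ w ∈ allWords b j ] g (a ∷ w))
    ≡⟨ *-distribˡ-∑∈ (allFin b) (fromℕ (b ^ d)) _ ⟨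
  fromℕ (b ^ d) *ℚ ∑[ a ∈ allFin b ] ∑[ w ∈ allWords b j ] g (a ∷ w)
    ≡⟨ cong (fromℕ (b ^ d) *ℚ_) (∑-allWords-suc b j g) ⟨
  fromℕ (b ^ d) *ℚ ∑∈ (allWords b (suc j)) g                   ∎
  where open ≡-Reasoning

∣∣≤∑-allWords∣∣ : ∀ {b j} (g : Vec (Fin b) j → ℚ) v → ∣ g v ∣ ≤ℚ ∑[ u ∈ allWords b j ] ∣ g u ∣
∣∣≤∑-allWords∣∣ {b} {j} g v = begin
  ∣ g v ∣                                           ≡⟨ ∑-allWords-δ v (∣_∣ ∘ g) ⟨
  ∑[ u ∈ allWords b j ] (𝟙 (v ≟ᵥ u) *ℚ ∣ g u ∣)     ≤⟨ ∑∈-mono (allWords b j) 𝟙*∣g∣≤∣g∣ ⟩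
  ∑[ u ∈ allWords b j ] ∣ g u ∣                     ∎
  where
  open ℚP.≤-Reasoning
  𝟙*∣g∣≤∣g∣ : ∀ u → 𝟙 (v ≟ᵥ u) *ℚ ∣ g u ∣ ≤ℚ ∣ g u ∣
  𝟙*∣g∣≤∣g∣ u = ℚP.≤-trans (*-monoʳ-≤-nonNeg′ (ℚP.0≤∣p∣ (g u)) (𝟙≤1 (v ≟ᵥ u)))
    (ℚP.≤-reflexive (ℚP.*-identityˡ _))

-- Windows

window : ∀ {A : Set} → (ℕ → A) → (j : ℕ) → ℕ → Vec A j
window y j i = Vec.tabulate (λ t → y (i ℕ.+ toℕ t))

take-tabulate : ∀ {A : Set} j {d} (f : Fin (j ℕ.+ d) → A) →
  take j (Vec.tabulate f) ≡ Vec.tabulate (f ∘ (_↑ˡ d))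
take-tabulate zero    f = refl
take-tabulate (suc j) f = cong (f Fin.zero ∷_) (take-tabulate j (f ∘ Fin.suc))

take-window : ∀ {A : Set} (y : ℕ → A) j d i → take j (window y (j ℕ.+ d) i) ≡ window y j i
take-window y j d i = trans (take-tabulate j _)
  (VecP.tabulate-cong (λ t → cong (λ s → y (i ℕ.+ s)) (FinP.toℕ-↑ˡ t d)))

window-periodic : ∀ {A : Set} {N} {y : ℕ → A} → Periodic N y → ∀ j → Periodic N (window y j)
window-periodic {N = N} {y} periodic j i = VecP.tabulate-cong (λ t →
  trans (cong y (ℕP.+-assoc i N (toℕ t))) (trans (cong (λ s → y (i ℕ.+ s)) (ℕP.+-comm N (toℕ t)))
  (trans (cong y (sym (ℕP.+-assoc i (toℕ t) N))) (periodic _))))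

window-wrap : ∀ {A : Set} (y : ℕ → A) n j i → i ℕ.+ j ≤ suc n →
  window (λ s → y (s % suc n)) j i ≡ window y j i
window-wrap y n j i i+j≤1+n = VecP.tabulate-cong (λ t →
  cong y (m<n⇒m%n≡m (ℕP.<-≤-trans (ℕP.+-monoʳ-< i (FinP.toℕ<n t)) i+j≤1+n)))

windowCount : ∀ {b} (x : ℕ → Fin b) k N → Vec (Fin b) k → ℚ
windowCount x k N u = ∑[ i < N ] 𝟙 (window x k i ≟ᵥ u)

module _ {b N} .{{_ : NonZero N}} {x : ℕ → Fin b} (periodic : Periodic N x) where

  necklace : Vec (Fin b) N
  necklace = Vec.tabulate (x ∘ toℕ)

  lookup-necklace : ∀ (i : Fin N) t → lookup necklace (idx i t) ≡ x (toℕ i ℕ.+ t)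
  lookup-necklace i t = trans (VecP.lookup∘tabulate (x ∘ toℕ) (idx i t))
    (trans (cong x (toℕ-idx N i)) (periodic-% periodic _))
    where
    toℕ-idx : ∀ N .{{_ : NonZero N}} (i : Fin N) → toℕ (idx i t) ≡ (toℕ i ℕ.+ t) % N
    toℕ-idx (suc N) i = FinP.toℕ-fromℕ< _

  occursAt⇒window : ∀ {k} (u : Vec (Fin b) k) i → OccursAt necklace u i → window x k (toℕ i) ≡ u
  occursAt⇒window u i occurs =
    trans (VecP.tabulate-cong (λ t → trans (sym (lookup-necklace i (toℕ t))) (occurs t))) (VecP.tabulate∘lookup u)

  window⇒occursAt : ∀ {k} (u : Vec (Fin b) k) i → window x k (toℕ i) ≡ u → OccursAt necklace u i
  window⇒occursAt u i wᵢ≡u t = trans (lookup-necklace i (toℕ t))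
    (trans (sym (VecP.lookup∘tabulate _ t)) (cong (λ w → lookup w t) wᵢ≡u))

  windowCount≡occurrences : ∀ {k} (u : Vec (Fin b) k) → windowCount x k N u ≡ fromℕ (occurrences necklace u)
  windowCount≡occurrences {k} u = sym (trans (length-filter (occursAt? necklace u) (allFin N))
    (trans (∑∈-cong (allFin N) (λ i → 𝟙-cong (occursAt⇒window u i) (window⇒occursAt u i)
                                             (occursAt? necklace u i) (window x k (toℕ i) ≟ᵥ u)))
           (∑∈-allFin N _)))

Balanced : ∀ {b j} → (ℕ → Fin b) → ℕ → Test b j → Set
Balanced {b} {j} x N t = ∑[ i < N ] t (window x j i) ≡ fromℕ N *ℚ tau b j t

∑-window-uniform : ∀ {b k} (x : ℕ → Fin b) N m → (∀ u → windowCount x k N u ≡ fromℕ m) →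
  (g : Vec (Fin b) k → ℚ) → ∑[ i < N ] g (window x k i) ≡ fromℕ m *ℚ ∑∈ (allWords b k) g
∑-window-uniform {b} {k} x N m uniform g = begin
  ∑[ i < N ] g (w i)                               ≡⟨ ∑<-cong N (λ i _ → ∑-allWords-δ (w i) g) ⟨
  ∑[ i < N ] ∑[ u ∈ W ] (𝟙 (w i ≟ᵥ u) *ℚ g u)      ≡⟨ ∑∈-∑<-comm W N _ ⟨
  ∑[ u ∈ W ] ∑[ i < N ] (𝟙 (w i ≟ᵥ u) *ℚ g u)      ≡⟨ ∑∈-cong W (λ u → *-distribʳ-∑< N _ (g u)) ⟨
  ∑[ u ∈ W ] (∑[ i < N ] 𝟙 (w i ≟ᵥ u) *ℚ g u)      ≡⟨ ∑∈-cong W (λ u → cong (_*ℚ g u) (uniform u)) ⟩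
  ∑[ u ∈ W ] (fromℕ m *ℚ g u)                      ≡⟨ *-distribˡ-∑∈ W (fromℕ m) g ⟨
  fromℕ m *ℚ ∑∈ W g                                ∎
  where
  open ≡-Reasoning
  W = allWords b k
  w = window x k

uniform⇒balanced : ∀ {b} .{{_ : NonZero b}} (x : ℕ → Fin b) j d m →
  (∀ u → windowCount x (j ℕ.+ d) (m * b ^ (j ℕ.+ d)) u ≡ fromℕ m) →
  (t : Test b j) → Balanced x (m * b ^ (j ℕ.+ d)) t
uniform⇒balanced {b} x j d m uniform t = begin
  ∑[ i < N ] t (window x j i)                       ≡⟨ ∑<-cong N (λ i _ → cong t (take-window x j d i)) ⟨
  ∑[ i < N ] t (take j (window x (j ℕ.+ d) i))      ≡⟨ ∑-window-uniform x N m uniform (t ∘ take j) ⟩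
  fromℕ m *ℚ ∑[ u ∈ allWords b (j ℕ.+ d) ] t (take j u)
    ≡⟨ cong (fromℕ m *ℚ_) (∑-allWords-take b j d t) ⟩
  fromℕ m *ℚ (fromℕ (b ^ d) *ℚ S)
    ≡⟨ ℚP.*-identityʳ _ ⟨
  fromℕ m *ℚ (fromℕ (b ^ d) *ℚ S) *ℚ 1ℚ
    ≡⟨ cong (fromℕ m *ℚ (fromℕ (b ^ d) *ℚ S) *ℚ_) (inv-*-fromℕ (b ^ j)) ⟨
  fromℕ m *ℚ (fromℕ (b ^ d) *ℚ S) *ℚ (inv (b ^ j) *ℚ fromℕ (b ^ j))
    ≡⟨ regroup (fromℕ m) (fromℕ (b ^ j)) (fromℕ (b ^ d)) S (inv (b ^ j)) ⟨
  fromℕ m *ℚ (fromℕ (b ^ j) *ℚ fromℕ (b ^ d)) *ℚ (S *ℚ inv (b ^ j))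
    ≡⟨ cong (λ z → fromℕ m *ℚ z *ℚ (S *ℚ inv (b ^ j))) (fromℕ-* (b ^ j) (b ^ d)) ⟨
  fromℕ m *ℚ fromℕ (b ^ j * b ^ d) *ℚ (S *ℚ inv (b ^ j))
    ≡⟨ cong (_*ℚ (S *ℚ inv (b ^ j))) (trans (cong (fromℕ ∘ (m *_)) (ℕP.^-distribˡ-+-* b j d)) (fromℕ-* m _)) ⟨
  fromℕ N *ℚ tau b j t ∎
  where
  open ≡-Reasoning
  instance
    b^j≢0 : NonZero (b ^ j)
    b^j≢0 = ℕP.m^n≢0 b j
  N = m * b ^ (j ℕ.+ d)
  S = ∑∈ (allWords b j) t
  regroup : ∀ m p q s i → m *ℚ (p *ℚ q) *ℚ (s *ℚ i) ≡ m *ℚ (q *ℚ s) *ℚ (i *ℚ p)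
  regroup = solve 5 (λ m p q s i → m :* (p :* q) :* (s :* i) := m :* (q :* s) :* (i :* p)) refl

-- Passing and rejecting

sampleSum : ∀ {b j} → (ℕ → Fin b) → Test b j → ℕ → ℚ
sampleSum {j = j} x t n = ∑[ i < suc n ] t (window (λ s → x (s % suc n)) j i)

stat-suc : ∀ {b j} (x : ℕ → Fin b) (t : Test b j) n →
  stat x t (suc n) ≡ ∣ sampleSum x t n *ℚ inv (suc n) - tau b j t ∣
stat-suc {b} {j} x t n = cong (λ S → ∣ S *ℚ inv (suc n) - tau b j t ∣)
  (∑∈-allFin (suc n) (λ i → t (window (λ s → x (s % suc n)) j i)))

∣*inv-∣≡∣-*∣*inv : ∀ n .{{_ : NonZero n}} S τ → ∣ S *ℚ inv n - τ ∣ ≡ ∣ S - fromℕ n *ℚ τ ∣ *ℚ inv n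
∣*inv-∣≡∣-*∣*inv n S τ = begin
  ∣ S *ℚ inv n - τ ∣                          ≡⟨ cong (λ z → ∣ S *ℚ inv n - z ∣) τ*1≡τ ⟨
  ∣ S *ℚ inv n - τ *ℚ (inv n *ℚ fromℕ n) ∣     ≡⟨ cong ∣_∣ (factor S τ (fromℕ n) (inv n)) ⟩
  ∣ (S - fromℕ n *ℚ τ) *ℚ inv n ∣             ≡⟨ ℚP.∣p*q∣≡∣p∣*∣q∣ (S - fromℕ n *ℚ τ) (inv n) ⟩
  ∣ S - fromℕ n *ℚ τ ∣ *ℚ ∣ inv n ∣           ≡⟨ cong (∣ S - fromℕ n *ℚ τ ∣ *ℚ_) (ℚP.0≤p⇒∣p∣≡p (0≤inv n)) ⟩
  ∣ S - fromℕ n *ℚ τ ∣ *ℚ inv n               ∎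
  where
  open ≡-Reasoning
  τ*1≡τ : τ *ℚ (inv n *ℚ fromℕ n) ≡ τ
  τ*1≡τ = trans (cong (τ *ℚ_) (inv-*-fromℕ n)) (ℚP.*-identityʳ τ)
  factor : ∀ S τ a i → S *ℚ i - τ *ℚ (i *ℚ a) ≡ (S - a *ℚ τ) *ℚ i
  factor = solve 4 (λ S τ a i → S :* i :- τ :* (i :* a) := (S :- a :* τ) :* i) refl

module _ {b j} (x : ℕ → Fin b) (t : Test b j) where

  passes-if-discrepancy-bounded : ∀ C → (∀ n → ∣ sampleSum x t n - fromℕ (suc n) *ℚ tau b j t ∣ ≤ℚ C) →
    Passes x t
  passes-if-discrepancy-bounded C bounded ε 0<ε = K , stat<ε
    where
    K = proj₁ (*-inv-suc-eventually-< C ε 0<ε)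
    stat<ε : ∀ n → K ≤ n → stat x t n <ℚ ε
    stat<ε zero    _     = 0<ε
    stat<ε (suc n) K≤1+n = begin-strict
      stat x t (suc n)
        ≡⟨ stat-suc x t n ⟩
      ∣ sampleSum x t n *ℚ inv (suc n) - tau b j t ∣
        ≡⟨ ∣*inv-∣≡∣-*∣*inv (suc n) (sampleSum x t n) (tau b j t) ⟩
      ∣ sampleSum x t n - fromℕ (suc n) *ℚ tau b j t ∣ *ℚ inv (suc n)
        ≤⟨ *-monoʳ-≤-nonNeg′ (0≤inv (suc n)) (bounded n) ⟩
      C *ℚ inv (suc n)
        <⟨ proj₂ (*-inv-suc-eventually-< C ε 0<ε) n K≤1+n ⟩
      ε ∎
      where open ℚP.≤-Reasoning

  rejected-if-stat-eventually-> : ∀ δ → 0ℚ <ℚ δ → ∀ K → (∀ n → K ≤ suc n → δ <ℚ stat x t (suc n)) → ¬ Passes x t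
  rejected-if-stat-eventually-> δ 0<δ K δ<stat passes =
    ℚP.<-asym (proj₂ (passes δ 0<δ) (suc n) N₀≤1+n) (δ<stat n K≤1+n)
    where
    N₀ = proj₁ (passes δ 0<δ)
    n = N₀ ℕ.+ K
    N₀≤1+n : N₀ ≤ suc n
    N₀≤1+n = ℕP.m≤n⇒m≤1+n (ℕP.m≤m+n N₀ K)
    K≤1+n : K ≤ suc n
    K≤1+n = ℕP.m≤n⇒m≤1+n (ℕP.m≤n+m K N₀)

module _ {b N} .{{_ : NonZero N}} {x : ℕ → Fin b} (periodic : Periodic N x) {j} (t : Test b j)
         (balanced : Balanced x N t) where

  private
    τ = tau b j t

    D : ℚ
    D = ∑[ u ∈ allWords b j ] ∣ t u ∣ + ∣ τ ∣

    centred : Vec (Fin b) j → ℚ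
    centred u = t u - τ

    ∣centred∣≤D : ∀ u → ∣ centred u ∣ ≤ℚ D
    ∣centred∣≤D u = ℚP.≤-trans (ℚP.∣p-q∣≤∣p∣+∣q∣ (t u) τ) (ℚP.+-monoˡ-≤ ∣ τ ∣ (∣∣≤∑-allWords∣∣ t u))

  sampleSum-discrepancy : ∀ n → ∣ sampleSum x t n - fromℕ (suc n) *ℚ τ ∣ ≤ℚ fromℕ j *ℚ (D + D) + fromℕ N *ℚ D
  sampleSum-discrepancy n = begin
    ∣ sampleSum x t n - fromℕ (suc n) *ℚ τ ∣            ≡⟨ cong ∣_∣ ∑g≡S-[1+n]τ ⟨
    ∣ ∑< (suc n) g ∣                                    ≡⟨ cong ∣_∣ (split (∑< (suc n) g) (∑< (suc n) f)) ⟩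
    ∣ (∑< (suc n) g - ∑< (suc n) f) + ∑< (suc n) f ∣    ≤⟨ ℚP.∣p+q∣≤∣p∣+∣q∣ (∑< (suc n) g - ∑< (suc n) f) _ ⟩
    ∣ ∑< (suc n) g - ∑< (suc n) f ∣ + ∣ ∑< (suc n) f ∣  ≤⟨ ℚP.+-mono-≤ wrap-error period-error ⟩
    fromℕ j *ℚ (D + D) + fromℕ N *ℚ D                   ∎
    where
    open ℚP.≤-Reasoning
    sample f g : ℕ → ℚ
    sample i = t (window (λ s → x (s % suc n)) j i)
    f i = centred (window x j i)
    g i = sample i - τ
    ∑g≡S-[1+n]τ : ∑< (suc n) g ≡ sampleSum x t n - fromℕ (suc n) *ℚ τ
    ∑g≡S-[1+n]τ = trans (∑<-distrib-- (suc n) sample (λ _ → τ))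
      (cong (_-_ (sampleSum x t n)) (∑<-const (suc n) τ))
    split : ∀ a c → a ≡ (a - c) + c
    split = solve 2 (λ a c → a := (a :- c) :+ c) refl
    wrap-error : ∣ ∑< (suc n) g - ∑< (suc n) f ∣ ≤ℚ fromℕ j *ℚ (D + D)
    wrap-error = ℚP.≤-trans (ℚP.≤-reflexive (cong ∣_∣ (sym (∑<-distrib-- (suc n) g f))))
      (∣∑<∣≤-tail (suc n) j (λ i → g i - f i)
        (λ i → ℚP.≤-trans (ℚP.∣p-q∣≤∣p∣+∣q∣ (g i) (f i)) (ℚP.+-mono-≤ (∣centred∣≤D _) (∣centred∣≤D _)))
        (λ i i+j≤1+n → trans (cong (λ w → centred w - f i) (window-wrap x n j i i+j≤1+n)) (ℚP.+-inverseʳ (f i))))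
    ∑f≡0 : ∑< N f ≡ 0ℚ
    ∑f≡0 = trans (∑<-distrib-- N (t ∘ window x j) (λ _ → τ))
      (trans (cong₂ _-_ balanced (∑<-const N τ)) (ℚP.+-inverseʳ (fromℕ N *ℚ τ)))
    period-error : ∣ ∑< (suc n) f ∣ ≤ℚ fromℕ N *ℚ D
    period-error =
      ∣∑<∣≤-periodic (cong centred ∘ window-periodic periodic j) ∑f≡0 (∣centred∣≤D ∘ window x j) (suc n)

  passes-if-balanced : Passes x t
  passes-if-balanced = passes-if-discrepancy-bounded x t _ sampleSum-discrepancy

occursInPeriod : ∀ {b} (x : ℕ → Fin b) N h → Test b h
occursInPeriod x N h w = 𝟙 (FinP.any? (λ (i : Fin N) → window x h (toℕ i) ≟ᵥ w))

module _ {b N} .{{_ : NonZero N}} {x : ℕ → Fin b} (periodic : Periodic N x) h (N<b^h : N < b ^ h) where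

  private
    test = occursInPeriod x N h

    instance
      b^h≢0 : NonZero (b ^ h)
      b^h≢0 = ℕ.>-nonZero (ℕP.≤-<-trans z≤n N<b^h)

    0≤test : ∀ w → 0ℚ ≤ℚ test w
    0≤test w = 0≤𝟙 (FinP.any? (λ (i : Fin N) → window x h (toℕ i) ≟ᵥ w))

    a : ℚ
    a = fromℕ N *ℚ inv (b ^ h)

    δ : ℚ
    δ = (1ℚ - a) *ℚ ½

  occursInPeriod-window : ∀ i → test (window x h i) ≡ 1ℚ
  occursInPeriod-window i = 𝟙-yes (Fin.fromℕ< (m%n<n i N) , wᵢ%N≡wᵢ)
    (FinP.any? (λ (i′ : Fin N) → window x h (toℕ i′) ≟ᵥ window x h i))
    where
    wᵢ%N≡wᵢ : window x h (toℕ (Fin.fromℕ< (m%n<n i N))) ≡ window x h i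
    wᵢ%N≡wᵢ = trans (cong (window x h) (FinP.toℕ-fromℕ< (m%n<n i N)))
      (periodic-% (window-periodic periodic h) i)

  occursInPeriod≤windowCount : ∀ w → test w ≤ℚ windowCount x h N w
  occursInPeriod≤windowCount w = bound (FinP.any? (λ (i : Fin N) → window x h (toℕ i) ≟ᵥ w))
    where
    bound : (d : Dec (∃ λ (i : Fin N) → window x h (toℕ i) ≡ w)) → 𝟙 d ≤ℚ windowCount x h N w
    bound (yes (i , wᵢ≡w)) = ℚP.≤-trans (ℚP.≤-reflexive (sym (𝟙-yes wᵢ≡w (window x h (toℕ i) ≟ᵥ w))))
      (term≤∑< N (λ i → 0≤𝟙 (window x h i ≟ᵥ w)) (FinP.toℕ<n i))
    bound (no _) = ∑<-nonNeg N (λ i → 0≤𝟙 (window x h i ≟ᵥ w))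

  ∑-occursInPeriod≤ : ∑∈ (allWords b h) test ≤ℚ fromℕ N
  ∑-occursInPeriod≤ = begin
    ∑∈ W test                                     ≤⟨ ∑∈-mono W occursInPeriod≤windowCount ⟩
    ∑[ w ∈ W ] ∑[ i < N ] 𝟙 (window x h i ≟ᵥ w)   ≡⟨ ∑∈-∑<-comm W N _ ⟩
    ∑[ i < N ] ∑[ w ∈ W ] 𝟙 (window x h i ≟ᵥ w)   ≡⟨ ∑<-cong N (λ i _ → each-window-once i) ⟩
    ∑[ i < N ] 1ℚ                                 ≡⟨ ∑<-const N 1ℚ ⟩
    fromℕ N *ℚ 1ℚ                                 ≡⟨ ℚP.*-identityʳ _ ⟩
    fromℕ N                                       ∎
    where
    open ℚP.≤-Reasoning
    W = allWords b h
    each-window-once : ∀ i → ∑[ w ∈ W ] 𝟙 (window x h i ≟ᵥ w) ≡ 1ℚ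
    each-window-once i = trans (∑∈-cong W (λ w → sym (ℚP.*-identityʳ _)))
      (∑-allWords-δ (window x h i) (λ _ → 1ℚ))

  private
    tau≤a : tau b h test ≤ℚ a
    tau≤a = *-monoʳ-≤-nonNeg′ (0≤inv (b ^ h)) ∑-occursInPeriod≤

    a<1 : a <ℚ 1ℚ
    a<1 = ℚP.<-≤-trans (ℚP.*-monoˡ-<-pos (inv (b ^ h)) {{inv-pos (b ^ h)}} (fromℕ-mono-< N<b^h))
      (ℚP.≤-reflexive (trans (ℚP.*-comm _ (inv (b ^ h))) (inv-*-fromℕ (b ^ h))))

    0<δ : 0ℚ <ℚ δ
    0<δ = ℚP.≤-<-trans (ℚP.≤-reflexive (sym (ℚP.*-zeroˡ ½)))
      (ℚP.*-monoˡ-<-pos ½ (ℚP.≤-<-trans (ℚP.≤-reflexive (sym (ℚP.+-inverseʳ a))) (ℚP.+-monoˡ-< (- a) a<1)))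

  sampleSum-occursInPeriod≥ : ∀ n → fromℕ (suc n) - fromℕ h ≤ℚ sampleSum x test n
  sampleSum-occursInPeriod≥ n = ∑<-≥-tail (suc n) h (λ i → test (window (λ s → x (s % suc n)) h i))
    (λ i → 0≤test _) (λ i i+h≤1+n → trans (cong test (window-wrap x n h i i+h≤1+n)) (occursInPeriod-window i))

  δ<stat-occursInPeriod : ∀ n → fromℕ h *ℚ inv (suc n) <ℚ δ → δ <ℚ stat x test (suc n)
  δ<stat-occursInPeriod n h/n<δ = ℚP.<-≤-trans δ<S/n-τ (ℚP.≤-reflexive
    (trans (sym (ℚP.0≤p⇒∣p∣≡p (ℚP.<⇒≤ (ℚP.<-trans 0<δ δ<S/n-τ)))) (sym (stat-suc x test n))))
    where
    S = sampleSum x test n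
    halve : ∀ a → 1ℚ - (1ℚ - a) *ℚ ½ - a ≡ (1ℚ - a) *ℚ ½
    halve = solve 1 (λ a → con 1ℚ :- (con 1ℚ :- a) :* con ½ :- a := (con 1ℚ :- a) :* con ½) refl
    expand : ∀ n h i → (n - h) *ℚ i ≡ i *ℚ n - h *ℚ i
    expand = solve 3 (λ n h i → (n :- h) :* i := i :* n :- h :* i) refl
    δ<S/n-τ : δ <ℚ S *ℚ inv (suc n) - tau b h test
    δ<S/n-τ = begin-strict
      δ
        ≡⟨ halve a ⟨
      1ℚ - δ - a
        <⟨ ℚP.+-monoˡ-< (- a) (ℚP.+-monoʳ-< 1ℚ (ℚP.neg-antimono-< h/n<δ)) ⟩
      1ℚ - fromℕ h *ℚ inv (suc n) - a
        ≡⟨ cong (λ z → z - fromℕ h *ℚ inv (suc n) - a) (inv-*-fromℕ (suc n)) ⟨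
      inv (suc n) *ℚ fromℕ (suc n) - fromℕ h *ℚ inv (suc n) - a
        ≡⟨ cong (_- a) (expand (fromℕ (suc n)) (fromℕ h) (inv (suc n))) ⟨
      (fromℕ (suc n) - fromℕ h) *ℚ inv (suc n) - a
        ≤⟨ ℚP.+-mono-≤ (*-monoʳ-≤-nonNeg′ (0≤inv (suc n)) (sampleSum-occursInPeriod≥ n))
                       (ℚP.neg-antimono-≤ tau≤a) ⟩
      S *ℚ inv (suc n) - tau b h test ∎
      where open ℚP.≤-Reasoning

  occursInPeriod-rejects : ¬ Passes x test
  occursInPeriod-rejects = rejected-if-stat-eventually-> x test δ 0<δ K
    (λ n K≤1+n → δ<stat-occursInPeriod n (proj₂ (*-inv-suc-eventually-< (fromℕ h) δ 0<δ) n K≤1+n))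
    where
    K = proj₁ (*-inv-suc-eventually-< (fromℕ h) δ 0<δ)

perfect⇒passes : ∀ {b k m} .{{_ : NonZero b}} .{{_ : NonZero m}} (x : ℕ → Fin b) → PerfectSeq b k m x →
  ∀ j → j ≤ k → (t : Test b j) → Passes x t
perfect⇒passes {b} {k} {m} x (periodic , _ , perfect) j j≤k t with ℕP.m≤n⇒∃[o]m+o≡n j≤k
... | d , refl = passes-if-balanced periodic t (uniform⇒balanced x j d m uniform t)
  where
  instance
    b^k≢0 : NonZero (b ^ k)
    b^k≢0 = ℕP.m^n≢0 b k
    N≢0 : NonZero (m * b ^ k)
    N≢0 = ℕP.m*n≢0 m (b ^ k)
  uniform : ∀ u → windowCount x k (m * b ^ k) u ≡ fromℕ m
  uniform u = trans (windowCount≡occurrences periodic u) (cong fromℕ (proj₁ (perfect u)))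

proposition4p1 : (b : ℕ) → 2 ≤ b → (k m : ℕ) → 1 ≤ k → .{{_ : NonZero m}} →
    (x : ℕ → Fin b) → PerfectSeq b k m x →
      (∀ (j : ℕ) → j ≤ k → (t : Test b j) → Passes x t)
      × (∀ (h : ℕ) → m * b ^ k < b ^ h → ∃ λ (t : Test b h) → ¬ Passes x t)
proposition4p1 b 2≤b k m _ x perfect@(periodic , _) =
  perfect⇒passes x perfect ,
  λ h N<b^h → occursInPeriod x (m * b ^ k) h , occursInPeriod-rejects periodic h N<b^h
  where
  instance
    b≢0 : NonZero b
    b≢0 = ℕ.>-nonZero (ℕP.<-≤-trans (s≤s z≤n) 2≤b)
    b^k≢0 : NonZero (b ^ k)
    b^k≢0 = ℕP.m^n≢0 b k
    N≢0 : NonZero (m * b ^ k)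
    N≢0 = ℕP.m*n≢0 m (b ^ k)
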